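{- Let $\mathbf m\ge 1$ and let $\mathrm{Ent}=\{1,\dots,\mathbf m\}\times\{1,2\}$ be the set of entries, the entry $(i,j)$ being written $ij$. Let $\mathcal P$ be a finite family of finite sequences of edges, where each edge $e$ carries a label $\mathrm{label}(e)\subseteq\mathrm{Ent}$. Let $\mathbf 2^{\mathbf m}$ be the set of total maps $\eta:\{1,\dots,\mathbf m\}\to\{1,2\}$, each identified with its graph $\{1\eta(1),\dots,\mathbf m\,\eta(\mathbf m)\}\subseteq\mathrm{Ent}$. Let $$\tau=\{\eta\in\mathbf 2^{\mathbf m}:\ \exists\, seq\in\mathcal P\ \forall e\in seq\ \ \eta\cap\mathrm{label}(e)\neq\emptyset\},$$ and $\tilde\tau=\mathbf 2^{\mathbf m}\setminus\tau$. Then the following are equivalent: (1) there is no compatible set of entries in $\tilde\tau$; (2) $\tau$ entails $\mathbf 2^{\mathbf m}$; (3) there is no compatible antichain in $\mathcal P$.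
   Context: A set of entries $S\subseteq\mathrm{Ent}$ is incompatible if it contains both $i1$ and $i2$ for some $i$; otherwise it is compatible. A set of edges is compatible if the union of their labels is a compatible set of entries. A set of edges $A$ is an antichain in $\mathcal P$ if every sequence $seq\in\mathcal P$ has some edge belonging to $A$. A set $T$ of partial maps from $\{1,\dots,\mathbf m\}$ to $\{1,2\}$ entails $\mathbf 2^{\mathbf m}$ if for every $\gamma\in\mathbf 2^{\mathbf m}$ some $\eta\in T$ is a restriction of $\gamma$. -}

module Defs where

open import Data.Nat using (ℕ)
open import Data.Fin using (Fin; zero; suc)
open import Data.Bool using (Bool; true)
open import Data.Maybe using (Maybe; just)
open import Data.Product using (Σ; ∃; _×_; _,_; proj₁; proj₂)
open import Data.List using (List)
open import Data.List.Membership.Propositional using (_∈_)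
open import Data.List.Relation.Unary.All using (All)
open import Data.List.Relation.Unary.Any using (Any)
open import Relation.Nullary using (¬_)
open import Relation.Binary.PropositionalEquality using (_≡_)

-- The second coordinate of an entry: zero stands for 1, suc zero for 2.
Ent : ℕ → Set
Ent m = Fin m × Fin 2

one two : Fin 2
one = zero
two = suc zero

EntSet : ℕ → Set₁
EntSet m = Ent m → Set

Compatible : {m : ℕ} → EntSet m → Set
Compatible {m} S = ¬ (Σ (Fin m) λ i → S (i , one) × S (i , two))

Total : ℕ → Set
Total m = Fin m → Fin 2

graph : {m : ℕ} → Total m → EntSet m
graph η (i , j) = η i ≡ j

Partial : ℕ → Set
Partial m = Fin m → Maybe (Fin 2)

IsRestrictionOf : {m : ℕ} → Partial m → Total m → Set
IsRestrictionOf {m} η γ = (i : Fin m) (j : Fin 2) → η i ≡ just j → γ i ≡ j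

Entails : {m : ℕ} → (Partial m → Set) → Set
Entails {m} T = (γ : Total m) → Σ (Partial m) λ η → T η × IsRestrictionOf η γ

module Setting {m : ℕ} {E : Set} (label : E → Ent m → Bool) (P : List (List E)) where

  InLabel : E → Ent m → Set
  InLabel e x = label e x ≡ true

  Meets : Total m → E → Set
  Meets η e = Σ (Ent m) λ x → graph η x × InLabel e x

  τ : Total m → Set
  τ η = Σ (List E) λ seq → seq ∈ P × All (Meets η) seq

  τ̃ : Total m → Set
  τ̃ η = ¬ τ η

  τᴾ : Partial m → Set
  τᴾ ρ = Σ (Total m) λ η → τ η × ((i : Fin m) → ρ i ≡ just (η i))

  ⋃Labels : (E → Set) → EntSet m
  ⋃Labels A x = Σ E λ e → A e × InLabel e x

  CompatibleEdges : (E → Set) → Set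
  CompatibleEdges A = Compatible (⋃Labels A)

  Antichain : (E → Set) → Set
  Antichain A = (seq : List E) → seq ∈ P → Any A seq

  Cond1 : Set
  Cond1 = ¬ (Σ (Total m) λ η → τ̃ η × Compatible (graph η))

  Cond2 : Set
  Cond2 = Entails τᴾ

  Cond3 : Set₁
  Cond3 = ¬ (Σ (E → Set) λ A → CompatibleEdges A × Antichain A)

-- Each of the three conditions says that τ is all of 2^m. For (2) this is because τ consists
-- of total maps; for (1) because the graph of a total map is always compatible and membership
-- in τ is decidable. For (3): if γ ∉ τ, the edges whose label misses γ form a compatible
-- antichain; conversely a compatible set of entries is missed by the graph of some total map
-- (pick, at each i, a value j with ij outside the set), and if that map lies in τ then every
-- antichain has an edge whose label meets it, so the antichain is not compatible.
module Submission where

open import Defs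
open import Data.Nat using (ℕ; _≥_)
open import Data.Bool using (Bool; true)
open import Data.Bool.Properties using () renaming (_≟_ to _≟ᵇ_)
open import Data.Fin using (Fin; zero; suc)
open import Data.Fin.Properties as Fin using (0≢1+n)
open import Data.Maybe using (just)
open import Data.Maybe.Properties using (just-injective)
open import Data.List using (List)
open import Data.List.Membership.Propositional using (find; lose)
open import Data.List.Relation.Unary.All as All using (All; all?)
open import Data.List.Relation.Unary.All.Properties using (¬All⇒Any¬)
open import Data.List.Relation.Unary.Any using (any?)
open import Data.Product using (Σ; _×_; _,_; proj₁; proj₂)
open import Function using (_∘_)
open import Function.Bundles using (_⇔_; mk⇔)
open import Function.Construct.Composition using (_⇔-∘_)
open import Function.Construct.Symmetry using (⇔-sym)
open import Relation.Nullary using (¬_; Dec; yes; no)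
open import Relation.Nullary.Decidable using (map′; decidable-stable; ¬¬-excluded-middle)
open import Relation.Nullary.Negation using (¬¬-map)
open import Relation.Unary using (Universal; Empty; _∩_)
open import Relation.Binary.PropositionalEquality using (_≡_; refl; trans; sym)

¬¬-Π-Fin : {n : ℕ} {Q : Fin n → Set} → ((i : Fin n) → ¬ ¬ Q i) → ¬ ¬ ((i : Fin n) → Q i)
¬¬-Π-Fin {ℕ.zero}  _  k = k λ ()
¬¬-Π-Fin {ℕ.suc n} ¬¬Q k = ¬¬Q zero λ q₀ → ¬¬-Π-Fin (¬¬Q ∘ suc) λ qₛ →
  k λ { zero → q₀ ; (suc i) → qₛ i }

graph-compatible : {m : ℕ} (η : Total m) → Compatible (graph η)
graph-compatible η (i , η≡one , η≡two) = 0≢1+n (trans (sym η≡one) η≡two)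

module _ {m : ℕ} {S : EntSet m} (compatible : Compatible S) where

  missedValue : (i : Fin m) → Dec (S (i , one)) → Σ (Fin 2) λ j → ¬ S (i , j)
  missedValue i (yes s₁) = two , λ s₂ → compatible (i , s₁ , s₂)
  missedValue i (no ¬s₁) = one , ¬s₁

  -- Only doubly negated: S need not be decidable, so the map cannot be computed.
  compatible⇒¬¬missedByGraph : ¬ ¬ (Σ (Total m) λ γ → Empty (graph γ ∩ S))
  compatible⇒¬¬missedByGraph =
    ¬¬-map missedByGraph (¬¬-Π-Fin λ i → ¬¬-map (missedValue i) ¬¬-excluded-middle)
    where
    missedByGraph : ((i : Fin m) → Σ (Fin 2) λ j → ¬ S (i , j)) → Σ (Total m) λ γ → Empty (graph γ ∩ S)
    missedByGraph f = proj₁ ∘ f , λ { (i , _) (refl , s) → proj₂ (f i) s }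

module _ {m : ℕ} {E : Set} (label : E → Ent m → Bool) (P : List (List E)) where
  open Setting label P

  meets? : (γ : Total m) (e : E) → Dec (Meets γ e)
  meets? γ e = map′ (λ (i , l) → (i , γ i) , refl , l)
                    (λ { ((i , _) , refl , l) → i , l })
                    (Fin.any? λ i → label e (i , γ i) ≟ᵇ true)

  τ? : (γ : Total m) → Dec (τ γ)
  τ? γ = map′ find (λ (s , s∈P , meetsAll) → lose s∈P meetsAll) (any? (all? (meets? γ)) P)

  τ-pointwise : {η γ : Total m} → ((i : Fin m) → η i ≡ γ i) → τ η → τ γ
  τ-pointwise {η} {γ} η≗γ (s , s∈P , meetsAll) = s , s∈P , All.map meets meetsAll
    where
    meets : ∀ {e} → Meets η e → Meets γ e
    meets ((i , j) , ηi≡j , l) = (i , j) , trans (sym (η≗γ i)) ηi≡j , l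

  missedEdges : Total m → E → Set
  missedEdges γ e = ¬ Meets γ e

  missedEdges-compatible : (γ : Total m) → CompatibleEdges (missedEdges γ)
  missedEdges-compatible γ (i , (e₁ , ¬meets₁ , l₁) , (e₂ , ¬meets₂ , l₂)) with γ i in γi≡
  ... | zero     = ¬meets₁ (_ , γi≡ , l₁)
  ... | suc zero = ¬meets₂ (_ , γi≡ , l₂)

  missedEdges-antichain : (γ : Total m) → τ̃ γ → Antichain (missedEdges γ)
  missedEdges-antichain γ γ∉τ s s∈P = ¬All⇒Any¬ (meets? γ) s λ meetsAll → γ∉τ (s , s∈P , meetsAll)

  universal⇒noCompatibleAntichain : Universal τ → Cond3
  universal⇒noCompatibleAntichain all∈τ (A , compatible , antichain) =
    compatible⇒¬¬missedByGraph {S = ⋃Labels A} compatible λ (γ , missed) →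
      let (s , s∈P , meetsAll) = all∈τ γ
          (e , e∈s , Ae)       = find (antichain s s∈P)
          (x , γx , l)         = All.lookup meetsAll e∈s
      in missed x (γx , e , Ae , l)

  cond1⇔universal : Cond1 ⇔ Universal τ
  cond1⇔universal = mk⇔
    (λ c γ → decidable-stable (τ? γ) λ γ∉τ → c (γ , γ∉τ , graph-compatible γ))
    (λ all∈τ (η , η∉τ , _) → η∉τ (all∈τ η))

  entails⇒universal : Cond2 → Universal τ
  entails⇒universal entails γ with entails γ
  ... | _ , (η , η∈τ , ρ≡η) , ρ⊆γ = τ-pointwise (λ i → sym (ρ⊆γ i (η i) (ρ≡η i))) η∈τ

  cond2⇔universal : Cond2 ⇔ Universal τ
  cond2⇔universal = mk⇔ entails⇒universal
    (λ all∈τ γ → just ∘ γ , (γ , all∈τ γ , λ _ → refl) , λ _ _ → just-injective)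

  cond3⇔universal : Cond3 ⇔ Universal τ
  cond3⇔universal = mk⇔
    (λ c γ → decidable-stable (τ? γ) λ γ∉τ →
      c (missedEdges γ , missedEdges-compatible γ , missedEdges-antichain γ γ∉τ))
    universal⇒noCompatibleAntichain

mainTheorem4 : (m : ℕ) → m ≥ 1 → (E : Set) (label : E → Ent m → Bool) (P : List (List E)) →
    let open Setting label P in
      (Cond1 ⇔ Cond2) × (Cond2 ⇔ Cond3)
mainTheorem4 m _ E label P =
    ⇔-sym (cond2⇔universal label P) ⇔-∘ cond1⇔universal label P
  , ⇔-sym (cond3⇔universal label P) ⇔-∘ cond2⇔universal label P
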